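{- Let $S_0=(s_{i,j})_{1\le i,j\le 3}$ be a $3\times 3$ array whose entries are $1,\ldots,9$, each used exactly once, and let $X:=\{s_{1,2},s_{1,3},s_{2,1},s_{2,3},s_{3,1},s_{3,2}\}$ be the set of its off-diagonal entries. Let $a\in\mathbb{Z}\setminus\{0\}$ satisfy \[ \{s_{1,2}+a,\ s_{1,3}-a,\ s_{2,1}-a,\ s_{2,3}+a,\ s_{3,1}+a,\ s_{3,2}-a\}=X. \] Then there is a unique triplet $y_1,y_2,y_3\in X$ with $y_1<y_2<y_3$ such that \[ \{y_1,y_2,y_3\}+\{0,a\}:=\{y_1,\,y_1+a,\,y_2,\,y_2+a,\,y_3,\,y_3+a\}=X. \]
   Context: The sum of sets denotes the Minkowski sum. -}

module Defs where

open import Data.Fin using (Fin; zero; suc)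
open import Data.Integer using (ℤ; +_; _+_; _-_; _≤_; _<_)
open import Data.Product using (_×_; Σ; ∃)
open import Data.Sum using (_⊎_)
open import Relation.Binary.PropositionalEquality using (_≡_)
open import Function.Bundles using (_⇔_)

-- A 3×3 array with integer entries; indices 0,1,2 stand for 1,2,3.
Array3 : Set
Array3 = Fin 3 → Fin 3 → ℤ

-- The entries of S are 1,…,9, each used exactly once:
-- every entry lies in [1,9] and distinct cells carry distinct entries
-- (9 distinct values in a 9-element range, i.e. a bijection onto {1,…,9}).
IsPermArray : Array3 → Set
IsPermArray S =
  (∀ i j → (+ 1 ≤ S i j) × (S i j ≤ + 9)) ×
  (∀ i j k l → S i j ≡ S k l → (i ≡ k) × (j ≡ l))

i1 i2 i3 : Fin 3
i1 = zero
i2 = suc zero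
i3 = suc (suc zero)

In6 : ℤ → ℤ → ℤ → ℤ → ℤ → ℤ → ℤ → Set
In6 z x₁ x₂ x₃ x₄ x₅ x₆ =
  z ≡ x₁ ⊎ z ≡ x₂ ⊎ z ≡ x₃ ⊎ z ≡ x₄ ⊎ z ≡ x₅ ⊎ z ≡ x₆

InX : Array3 → ℤ → Set
InX S z = In6 z (S i1 i2) (S i1 i3) (S i2 i1) (S i2 i3) (S i3 i1) (S i3 i2)

InShifted : Array3 → ℤ → ℤ → Set
InShifted S a z =
  In6 z (S i1 i2 + a) (S i1 i3 - a) (S i2 i1 - a)
        (S i2 i3 + a) (S i3 i1 + a) (S i3 i2 - a)

InTripletSum : ℤ → ℤ → ℤ → ℤ → ℤ → Set
InTripletSum y₁ y₂ y₃ a z = In6 z y₁ (y₁ + a) y₂ (y₂ + a) y₃ (y₃ + a)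

GoodTriplet : Array3 → ℤ → ℤ → ℤ → ℤ → Set
GoodTriplet S a y₁ y₂ y₃ =
  InX S y₁ × InX S y₂ × InX S y₃ × y₁ < y₂ × y₂ < y₃ ×
  (∀ z → InTripletSum y₁ y₂ y₃ a z ⇔ InX S z)

-- Split the off-diagonal entries into R = {s₁₂, s₂₃, s₃₁}, which the hypothesis
-- shifts by +a, and L = {s₁₃, s₂₁, s₃₂}, shifted by -a.  If x ∈ R but x + a ∉ L,
-- then x - a ∈ R; repeating, the progression x, x - a, x - 2a, … would stay inside
-- the bounded set R, which is impossible.  Hence R + a ⊆ L, symmetrically L - a ⊆ R,
-- so X = R ∪ (R + a) and the sorted R is a solution.  For uniqueness, any solution
-- W satisfies W ∩ (W + a) = ∅ because the six entries of X are distinct; then an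
-- x ∈ W ∖ R forces x - a ∈ R ∖ W and x - 2a ∈ W ∖ R, again an endless descent.
module Submission where

open import Defs
open import Level using (Level; 0ℓ)
open import Data.Empty using (⊥-elim)
open import Data.Fin using (Fin; zero; suc; #_; punchOut; _≟_)
open import Data.Fin.Properties using (punchOut-injective; injective⇒≤)
open import Data.Integer
  using (ℤ; +_; 0ℤ; +0; +[1+_]; -[1+_]; _+_; _-_; -_; _≤_; _<_; _>_; ∣_∣; +≤+; +<+)
open import Data.Integer.Properties
  using ( <-cmp; ≤-antisym; <⇒≤; <-irrefl; <-trans; ≤-refl; +-identityʳ
        ; +-monoˡ-<; +-monoʳ-<; neg-mono-<; neg-injective; neg-involutive; i≤j⇒0≤j-i)
open import Data.Integer.Tactic.RingSolver using (solve-∀)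
open import Data.Nat as ℕ using (ℕ)
import Data.Nat.Properties as ℕ
open import Data.Nat.Induction using (<-wellFounded)
open import Data.Product using (_×_; _,_; proj₁; proj₂; ∃; Σ-syntax; uncurry; swap)
open import Data.Product.Properties using (×-≡,≡→≡)
open import Data.Sum using (_⊎_; inj₁; inj₂; [_,_]) renaming (map to ⊎-map)
open import Data.Vec using (Vec; []; _∷_; lookup; tabulate)
open import Data.Vec.Properties using (lookup∘tabulate)
open import Function using (_∘_; id)
open import Function.Bundles using (_⇔_; mk⇔; Equivalence)
open import Function.Definitions using (Injective)
open import Induction.WellFounded using (module All)
import Relation.Binary.Construct.On as On
open import Relation.Binary.Definitions using (tri<; tri≈; tri>)
open import Relation.Binary.PropositionalEquality
  using (_≡_; _≢_; refl; sym; trans; cong; subst; module ≡-Reasoning)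
open import Relation.Nullary using (yes; no; contradiction)
open import Relation.Unary using (Pred; _⊆_; _∪_; _≐_; _⊥_)
open import Relation.Unary.Properties using (≐-refl; ≐-sym; ≐-trans)

private
  variable
    ℓ ℓ₁ ℓ₂ : Level
    a c lo hi : ℤ

-- Induction along arithmetic progressions in a bounded set of integers

Interval : ℤ → ℤ → Pred ℤ 0ℓ
Interval lo hi x = lo ≤ x × x ≤ hi

∣∣-mono-< : ∀ {i j} → 0ℤ ≤ i → i < j → ∣ i ∣ ℕ.< ∣ j ∣
∣∣-mono-< (+≤+ _) (+<+ m<n) = m<n

i-j<i : ∀ {i j} → 0ℤ < j → i - j < i
i-j<i {i} 0<j = subst (i - _ <_) (+-identityʳ i) (+-monoʳ-< i (neg-mono-< 0<j))

i<i-j : ∀ {i j} → j < 0ℤ → i < i - j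
i<i-j {i} j<0 = subst (_< i - _) (+-identityʳ i) (+-monoʳ-< i (neg-mono-< j<0))

measure-induction : {Q : Pred ℤ ℓ₁} {R : Pred ℤ ℓ₂}
  (μ : ℤ → ℕ) (_≺_ : ℤ → ℤ → Set) →
  (∀ {x y} → Q y → y ≺ x → μ y ℕ.< μ x) →
  (∀ {x} → Q x → (∀ {y} → y ≺ x → Q y → R y) → R x) → Q ⊆ R
measure-induction {Q = Q} {R} μ _≺_ decreasing step {x} =
  All.wfRec (On.wellFounded μ <-wellFounded) _ (λ x → Q x → R x)
    (λ _ ih Qx → step Qx (λ y≺x Qy → ih (decreasing Qy y≺x) Qy)) x

bounded-below-induction : {Q : Pred ℤ ℓ₁} {R : Pred ℤ ℓ₂} →
  (∀ {x} → Q x → lo ≤ x) →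
  (∀ {x} → Q x → (∀ {y} → y < x → Q y → R y) → R x) → Q ⊆ R
bounded-below-induction {lo = lo} bounded =
  measure-induction (λ x → ∣ x - lo ∣) _<_
    (λ Qy y<x → ∣∣-mono-< (i≤j⇒0≤j-i (bounded Qy)) (+-monoˡ-< (- lo) y<x))

bounded-above-induction : {Q : Pred ℤ ℓ₁} {R : Pred ℤ ℓ₂} →
  (∀ {x} → Q x → x ≤ hi) →
  (∀ {x} → Q x → (∀ {y} → y > x → Q y → R y) → R x) → Q ⊆ R
bounded-above-induction {hi = hi} bounded =
  measure-induction (λ x → ∣ hi - x ∣) _>_
    (λ Qy x<y → ∣∣-mono-< (i≤j⇒0≤j-i (bounded Qy)) (+-monoʳ-< hi (neg-mono-< x<y)))

progression-induction : {Q : Pred ℤ ℓ₁} {R : Pred ℤ ℓ₂} →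
  c ≢ 0ℤ → Q ⊆ Interval lo hi →
  (∀ {x} → Q x → (Q (x - c) → R (x - c)) → R x) → Q ⊆ R
progression-induction {c = c} c≢0 bounded step with <-cmp c 0ℤ
... | tri< c<0 _ _ = bounded-above-induction (proj₂ ∘ bounded) (λ Qx ih → step Qx (ih (i<i-j c<0)))
... | tri≈ _ c≡0 _ = ⊥-elim (c≢0 c≡0)
... | tri> _ _ 0<c = bounded-below-induction (proj₁ ∘ bounded) (λ Qx ih → step Qx (ih (i-j<i 0<c)))

-- Translates of sets of integers

infixl 7 _⊕_

_⊕_ : Pred ℤ ℓ → ℤ → Pred ℤ ℓ
(A ⊕ a) x = A (x - a)

i-j+j≡i : ∀ i j → i - j + j ≡ i
i-j+j≡i = solve-∀

i+j-j≡i : ∀ i j → i + j - j ≡ i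
i+j-j≡i = solve-∀

i-j-j≡i-[j+j] : ∀ i j → i - j - j ≡ i - (j + j)
i-j-j≡i-[j+j] = solve-∀

i≡j+k⇒i-k≡j : ∀ {i j k} → i ≡ j + k → i - k ≡ j
i≡j+k⇒i-k≡j {k = k} refl = i+j-j≡i _ k

i≡j-k⇒i+k≡j : ∀ {i j k} → i ≡ j - k → i + k ≡ j
i≡j-k⇒i+k≡j {k = k} refl = i-j+j≡i _ k

i-k≡j⇒i≡j+k : ∀ {i j k} → i - k ≡ j → i ≡ j + k
i-k≡j⇒i≡j+k {i} {k = k} refl = sym (i-j+j≡i i k)

neg≢0 : a ≢ 0ℤ → - a ≢ 0ℤ
neg≢0 a≢0 = a≢0 ∘ neg-injective

i+i≢0 : a ≢ 0ℤ → a + a ≢ 0ℤ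
i+i≢0 {+0}       a≢0 = contradiction refl a≢0
i+i≢0 {+[1+ _ ]} _   ()
i+i≢0 { -[1+ _ ]} _  ()

translate-into : {A B : Pred ℤ ℓ} → a ≢ 0ℤ → A ⊆ Interval lo hi → A ⊥ B →
  (∀ {x} → A x → A (x - a) ⊎ B (x + a)) →
  ∀ {x} → A x → B (x + a)
translate-into {a = a} {A = A} {B} a≢0 bounded A⊥B cover = progression-induction a≢0 bounded step
  where
  step : ∀ {x} → A x → (A (x - a) → B (x - a + a)) → B (x + a)
  step {x} Ax ih =
    [ (λ A[x-a] → ⊥-elim (A⊥B (Ax , subst B (i-j+j≡i x a) (ih A[x-a])))) , id ] (cover Ax)

translate≐ : {A B : Pred ℤ ℓ} → a ≢ 0ℤ →
  A ⊆ Interval lo hi → B ⊆ Interval lo hi → A ⊥ B →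
  (∀ {x} → A x ⊎ B x → A (x - a) ⊎ B (x + a)) → A ⊕ a ≐ B
translate≐ {a = a} {A = A} {B} a≢0 A-bounded B-bounded A⊥B cover =
  (λ {x} A[x-a] → subst B (i-j+j≡i x a) (translate-into a≢0 A-bounded A⊥B (λ Ax → cover (inj₁ Ax)) A[x-a])) ,
  translate-into (neg≢0 a≢0) B-bounded (A⊥B ∘ swap) (λ {x} Bx → reverse-cover {x} (cover (inj₂ Bx)))
  where
  reverse-cover : ∀ {x} → A (x - a) ⊎ B (x + a) → B (x - - a) ⊎ A (x + - a)
  reverse-cover {x} = [ inj₂ , inj₁ ∘ subst B (cong (λ b → x + b) (sym (neg-involutive a))) ]

∪-⊕-cong : {A B : Pred ℤ ℓ} → A ≐ B → A ∪ A ⊕ a ≐ B ∪ B ⊕ a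
∪-⊕-cong (A⊆B , B⊆A) = ⊎-map A⊆B A⊆B , ⊎-map B⊆A B⊆A

decomposition-⊆ : {V W : Pred ℤ ℓ} → a ≢ 0ℤ → W ⊆ Interval lo hi →
  V ⊥ V ⊕ a → W ⊥ W ⊕ a → W ∪ W ⊕ a ≐ V ∪ V ⊕ a → W ⊆ V
decomposition-⊆ {a = a} {V = V} {W} a≢0 bounded V⊥V⊕a W⊥W⊕a (W⊆V , V⊆W) =
  progression-induction (i+i≢0 a≢0) bounded step
  where
  step : ∀ {x} → W x → (W (x - (a + a)) → V (x - (a + a))) → V x
  step {x} Wx ih with W⊆V (inj₁ Wx)
  ... | inj₁ Vx = Vx
  ... | inj₂ V[x-a] with V⊆W (inj₁ V[x-a])
  ...   | inj₁ W[x-a] = ⊥-elim (W⊥W⊕a (Wx , W[x-a]))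
  ...   | inj₂ W[x-a-a] = ⊥-elim (V⊥V⊕a (V[x-a] , V[x-a-a]))
    where
    V[x-a-a] : V (x - a - a)
    V[x-a-a] = subst V (sym (i-j-j≡i-[j+j] x a))
                 (ih (subst W (i-j-j≡i-[j+j] x a) W[x-a-a]))

decomposition-unique : {V W : Pred ℤ ℓ} → a ≢ 0ℤ →
  V ⊆ Interval lo hi → W ⊆ Interval lo hi → V ⊥ V ⊕ a → W ⊥ W ⊕ a →
  W ∪ W ⊕ a ≐ V ∪ V ⊕ a → W ≐ V
decomposition-unique a≢0 V-bounded W-bounded V⊥V⊕a W⊥W⊕a same =
  decomposition-⊆ a≢0 W-bounded V⊥V⊕a W⊥W⊕a same ,
  decomposition-⊆ a≢0 V-bounded W⊥W⊕a V⊥V⊕a (≐-sym same)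

-- Three-element sets and their sorting

Triple : ℤ → ℤ → ℤ → Pred ℤ 0ℓ
Triple x y z w = w ≡ x ⊎ w ≡ y ⊎ w ≡ z

Triple-swap₁₂ : ∀ {x y z} → Triple x y z ⊆ Triple y x z
Triple-swap₁₂ (inj₁ e)        = inj₂ (inj₁ e)
Triple-swap₁₂ (inj₂ (inj₁ e)) = inj₁ e
Triple-swap₁₂ (inj₂ (inj₂ e)) = inj₂ (inj₂ e)

Triple-swap₂₃ : ∀ {x y z} → Triple x y z ⊆ Triple x z y
Triple-swap₂₃ (inj₁ e)        = inj₁ e
Triple-swap₂₃ (inj₂ (inj₁ e)) = inj₂ (inj₂ e)
Triple-swap₂₃ (inj₂ (inj₂ e)) = inj₂ (inj₁ e)

swap₁₂ : ∀ {x y z} → Triple x y z ≐ Triple y x z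
swap₁₂ = Triple-swap₁₂ , Triple-swap₁₂

swap₂₃ : ∀ {x y z} → Triple x y z ≐ Triple x z y
swap₂₃ = Triple-swap₂₃ , Triple-swap₂₃

record Sorting (x y z : ℤ) : Set where
  constructor sorting
  field
    {y₁ y₂ y₃} : ℤ
    y₁<y₂ : y₁ < y₂
    y₂<y₃ : y₂ < y₃
    same  : Triple y₁ y₂ y₃ ≐ Triple x y z

insert : ∀ {x u v} → u < v → x ≢ u → x ≢ v → Sorting x u v
insert {x} {u} {v} u<v x≢u x≢v with <-cmp x u
... | tri< x<u _ _ = sorting x<u u<v ≐-refl
... | tri≈ _ x≡u _ = contradiction x≡u x≢u
... | tri> _ _ u<x with <-cmp x v
...   | tri< x<v _ _ = sorting u<x x<v swap₁₂
...   | tri≈ _ x≡v _ = contradiction x≡v x≢v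
...   | tri> _ _ v<x = sorting u<v v<x (≐-trans swap₂₃ swap₁₂)

sort : ∀ {x y z} → x ≢ y → y ≢ z → x ≢ z → Sorting x y z
sort {y = y} {z} x≢y y≢z x≢z with <-cmp y z
... | tri< y<z _ _ = insert y<z x≢y x≢z
... | tri≈ _ y≡z _ = contradiction y≡z y≢z
... | tri> _ _ z<y = let sorting p q s = insert z<y x≢z x≢y in sorting p q (≐-trans s swap₂₃)

Triple-min : ∀ {x₁ x₂ x₃} → x₁ < x₂ → x₂ < x₃ → Triple x₁ x₂ x₃ ⊆ (x₁ ≤_)
Triple-min x₁<x₂ x₂<x₃ (inj₁ refl)        = ≤-refl
Triple-min x₁<x₂ x₂<x₃ (inj₂ (inj₁ refl)) = <⇒≤ x₁<x₂
Triple-min x₁<x₂ x₂<x₃ (inj₂ (inj₂ refl)) = <⇒≤ (<-trans x₁<x₂ x₂<x₃)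

Triple-max : ∀ {x₁ x₂ x₃} → x₁ < x₂ → x₂ < x₃ → Triple x₁ x₂ x₃ ⊆ (_≤ x₃)
Triple-max x₁<x₂ x₂<x₃ (inj₁ refl)        = <⇒≤ (<-trans x₁<x₂ x₂<x₃)
Triple-max x₁<x₂ x₂<x₃ (inj₂ (inj₁ refl)) = <⇒≤ x₂<x₃
Triple-max x₁<x₂ x₂<x₃ (inj₂ (inj₂ refl)) = ≤-refl

sorted-unique : ∀ {x₁ x₂ x₃ y₁ y₂ y₃} →
  x₁ < x₂ → x₂ < x₃ → y₁ < y₂ → y₂ < y₃ →
  Triple x₁ x₂ x₃ ≐ Triple y₁ y₂ y₃ → (x₁ ≡ y₁) × (x₂ ≡ y₂) × (x₃ ≡ y₃)
sorted-unique {x₁} {x₂} {x₃} {y₁} {y₂} {y₃} x₁<x₂ x₂<x₃ y₁<y₂ y₂<y₃ (x⊆y , y⊆x) =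
  x₁≡y₁ , x₂≡y₂ , x₃≡y₃
  where
  x₁≡y₁ : x₁ ≡ y₁
  x₁≡y₁ = ≤-antisym (Triple-min x₁<x₂ x₂<x₃ (y⊆x (inj₁ refl)))
                    (Triple-min y₁<y₂ y₂<y₃ (x⊆y (inj₁ refl)))
  x₃≡y₃ : x₃ ≡ y₃
  x₃≡y₃ = ≤-antisym (Triple-max y₁<y₂ y₂<y₃ (x⊆y (inj₂ (inj₂ refl))))
                    (Triple-max x₁<x₂ x₂<x₃ (y⊆x (inj₂ (inj₂ refl))))
  x₂≡y₂ : x₂ ≡ y₂
  x₂≡y₂ with x⊆y (inj₂ (inj₁ refl))
  ... | inj₁ x₂≡y₁        = contradiction x₁<x₂ (<-irrefl (trans x₁≡y₁ (sym x₂≡y₁)))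
  ... | inj₂ (inj₁ x₂≡y₂) = x₂≡y₂
  ... | inj₂ (inj₂ x₂≡y₃) = contradiction x₂<x₃ (<-irrefl (trans x₂≡y₃ (sym x₃≡y₃)))

-- The values of g all appear among those of f; were f i ≡ f i' with i ≢ i',
-- the value f i' could be replaced by f i, squeezing n distinct values into n - 1 slots.
covering-injective : ∀ {n} {A : Set ℓ} {f g : Fin n → A} →
  Injective _≡_ _≡_ g → (∀ j → ∃ λ i → g j ≡ f i) → Injective _≡_ _≡_ f
covering-injective {n = ℕ.zero} _ _ {()}
covering-injective {n = ℕ.suc n} {f = f} {g} g-injective covered {i} {i′} fi≡fi′ with i ≟ i′
... | yes i≡i′ = i≡i′
... | no i≢i′ = contradiction (injective⇒≤ squeeze-injective) ℕ.1+n≰n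
  where
  avoiding : ∀ j → ∃ λ k → i′ ≢ k × g j ≡ f k
  avoiding j with covered j
  ... | k , gj≡fk with k ≟ i′
  ...   | yes refl = i , i≢i′ ∘ sym , trans gj≡fk (sym fi≡fi′)
  ...   | no k≢i′  = k , k≢i′ ∘ sym , gj≡fk
  squeeze : Fin (ℕ.suc n) → Fin n
  squeeze j = punchOut (proj₁ (proj₂ (avoiding j)))
  squeeze-injective : Injective _≡_ _≡_ squeeze
  squeeze-injective {j} {k} e = g-injective (begin
    g j                       ≡⟨ proj₂ (proj₂ (avoiding j)) ⟩
    f (proj₁ (avoiding j))    ≡⟨ cong f (punchOut-injective (proj₁ (proj₂ (avoiding j))) (proj₁ (proj₂ (avoiding k))) e) ⟩
    f (proj₁ (avoiding k))    ≡⟨ sym (proj₂ (proj₂ (avoiding k))) ⟩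
    g k                       ∎)
    where open ≡-Reasoning

In6⇒lookup : ∀ {z x₁ x₂ x₃ x₄ x₅ x₆} → In6 z x₁ x₂ x₃ x₄ x₅ x₆ →
  ∃ λ i → z ≡ lookup (x₁ ∷ x₂ ∷ x₃ ∷ x₄ ∷ x₅ ∷ x₆ ∷ []) i
In6⇒lookup (inj₁ e)                                = # 0 , e
In6⇒lookup (inj₂ (inj₁ e))                         = # 1 , e
In6⇒lookup (inj₂ (inj₂ (inj₁ e)))                  = # 2 , e
In6⇒lookup (inj₂ (inj₂ (inj₂ (inj₁ e))))           = # 3 , e
In6⇒lookup (inj₂ (inj₂ (inj₂ (inj₂ (inj₁ e)))))    = # 4 , e
In6⇒lookup (inj₂ (inj₂ (inj₂ (inj₂ (inj₂ e)))))    = # 5 , e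

lookup⇒In6 : ∀ {x₁ x₂ x₃ x₄ x₅ x₆} i →
  In6 (lookup (x₁ ∷ x₂ ∷ x₃ ∷ x₄ ∷ x₅ ∷ x₆ ∷ []) i) x₁ x₂ x₃ x₄ x₅ x₆
lookup⇒In6 zero                                = inj₁ refl
lookup⇒In6 (suc zero)                          = inj₂ (inj₁ refl)
lookup⇒In6 (suc (suc zero))                    = inj₂ (inj₂ (inj₁ refl))
lookup⇒In6 (suc (suc (suc zero)))              = inj₂ (inj₂ (inj₂ (inj₁ refl)))
lookup⇒In6 (suc (suc (suc (suc zero))))        = inj₂ (inj₂ (inj₂ (inj₂ (inj₁ refl))))
lookup⇒In6 (suc (suc (suc (suc (suc zero))))) = inj₂ (inj₂ (inj₂ (inj₂ (inj₂ refl))))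

TripletSum⇒Triple∪⊕ : ∀ {y₁ y₂ y₃} → InTripletSum y₁ y₂ y₃ a ⊆ Triple y₁ y₂ y₃ ∪ Triple y₁ y₂ y₃ ⊕ a
TripletSum⇒Triple∪⊕ (inj₁ e)                             = inj₁ (inj₁ e)
TripletSum⇒Triple∪⊕ (inj₂ (inj₁ e))                      = inj₂ (inj₁ (i≡j+k⇒i-k≡j e))
TripletSum⇒Triple∪⊕ (inj₂ (inj₂ (inj₁ e)))               = inj₁ (inj₂ (inj₁ e))
TripletSum⇒Triple∪⊕ (inj₂ (inj₂ (inj₂ (inj₁ e))))        = inj₂ (inj₂ (inj₁ (i≡j+k⇒i-k≡j e)))
TripletSum⇒Triple∪⊕ (inj₂ (inj₂ (inj₂ (inj₂ (inj₁ e))))) = inj₁ (inj₂ (inj₂ e))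
TripletSum⇒Triple∪⊕ (inj₂ (inj₂ (inj₂ (inj₂ (inj₂ e))))) = inj₂ (inj₂ (inj₂ (i≡j+k⇒i-k≡j e)))

Triple∪⊕⇒TripletSum : ∀ {y₁ y₂ y₃} → Triple y₁ y₂ y₃ ∪ Triple y₁ y₂ y₃ ⊕ a ⊆ InTripletSum y₁ y₂ y₃ a
Triple∪⊕⇒TripletSum (inj₁ (inj₁ e))        = inj₁ e
Triple∪⊕⇒TripletSum (inj₁ (inj₂ (inj₁ e))) = inj₂ (inj₂ (inj₁ e))
Triple∪⊕⇒TripletSum (inj₁ (inj₂ (inj₂ e))) = inj₂ (inj₂ (inj₂ (inj₂ (inj₁ e))))
Triple∪⊕⇒TripletSum (inj₂ (inj₁ e))        = inj₂ (inj₁ (i-k≡j⇒i≡j+k e))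
Triple∪⊕⇒TripletSum (inj₂ (inj₂ (inj₁ e))) = inj₂ (inj₂ (inj₂ (inj₁ (i-k≡j⇒i≡j+k e))))
Triple∪⊕⇒TripletSum (inj₂ (inj₂ (inj₂ e))) = inj₂ (inj₂ (inj₂ (inj₂ (inj₂ (i-k≡j⇒i≡j+k e)))))

TripletSum≐Triple∪⊕ : ∀ {y₁ y₂ y₃} → InTripletSum y₁ y₂ y₃ a ≐ Triple y₁ y₂ y₃ ∪ Triple y₁ y₂ y₃ ⊕ a
TripletSum≐Triple∪⊕ = TripletSum⇒Triple∪⊕ , Triple∪⊕⇒TripletSum

Triple⊥Triple⊕ : ∀ {y₁ y₂ y₃} →
  Injective _≡_ _≡_ (lookup (y₁ ∷ y₁ + a ∷ y₂ ∷ y₂ + a ∷ y₃ ∷ y₃ + a ∷ [])) →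
  Triple y₁ y₂ y₃ ⊥ Triple y₁ y₂ y₃ ⊕ a
Triple⊥Triple⊕ inj (inj₁ refl , inj₁ e) =
  contradiction (inj {# 0} {# 1} (i-k≡j⇒i≡j+k e)) λ ()
Triple⊥Triple⊕ inj (inj₁ refl , inj₂ (inj₁ e)) =
  contradiction (inj {# 0} {# 3} (i-k≡j⇒i≡j+k e)) λ ()
Triple⊥Triple⊕ inj (inj₁ refl , inj₂ (inj₂ e)) =
  contradiction (inj {# 0} {# 5} (i-k≡j⇒i≡j+k e)) λ ()
Triple⊥Triple⊕ inj (inj₂ (inj₁ refl) , inj₁ e) =
  contradiction (inj {# 2} {# 1} (i-k≡j⇒i≡j+k e)) λ ()
Triple⊥Triple⊕ inj (inj₂ (inj₁ refl) , inj₂ (inj₁ e)) =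
  contradiction (inj {# 2} {# 3} (i-k≡j⇒i≡j+k e)) λ ()
Triple⊥Triple⊕ inj (inj₂ (inj₁ refl) , inj₂ (inj₂ e)) =
  contradiction (inj {# 2} {# 5} (i-k≡j⇒i≡j+k e)) λ ()
Triple⊥Triple⊕ inj (inj₂ (inj₂ refl) , inj₁ e) =
  contradiction (inj {# 4} {# 1} (i-k≡j⇒i≡j+k e)) λ ()
Triple⊥Triple⊕ inj (inj₂ (inj₂ refl) , inj₂ (inj₁ e)) =
  contradiction (inj {# 4} {# 3} (i-k≡j⇒i≡j+k e)) λ ()
Triple⊥Triple⊕ inj (inj₂ (inj₂ refl) , inj₂ (inj₂ e)) =
  contradiction (inj {# 4} {# 5} (i-k≡j⇒i≡j+k e)) λ ()

offDiagonalCell : Fin 6 → Fin 3 × Fin 3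
offDiagonalCell = lookup ((i1 , i2) ∷ (i1 , i3) ∷ (i2 , i1) ∷ (i2 , i3) ∷ (i3 , i1) ∷ (i3 , i2) ∷ [])

cellIndex : Fin 3 × Fin 3 → Fin 6
cellIndex (zero , suc zero)           = # 0
cellIndex (zero , suc (suc zero))     = # 1
cellIndex (suc zero , zero)           = # 2
cellIndex (suc zero , suc (suc zero)) = # 3
cellIndex (suc (suc zero) , zero)     = # 4
cellIndex (suc (suc zero) , suc zero) = # 5
cellIndex _                           = # 0

cellIndex-offDiagonalCell : ∀ j → cellIndex (offDiagonalCell j) ≡ j
cellIndex-offDiagonalCell zero                                = refl
cellIndex-offDiagonalCell (suc zero)                          = refl
cellIndex-offDiagonalCell (suc (suc zero))                    = refl
cellIndex-offDiagonalCell (suc (suc (suc zero)))              = refl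
cellIndex-offDiagonalCell (suc (suc (suc (suc zero))))        = refl
cellIndex-offDiagonalCell (suc (suc (suc (suc (suc zero))))) = refl

offDiagonalCell-injective : Injective _≡_ _≡_ offDiagonalCell
offDiagonalCell-injective {j} {k} e =
  trans (sym (cellIndex-offDiagonalCell j)) (trans (cong cellIndex e) (cellIndex-offDiagonalCell k))

-- Listed in the order of InX, so that InX S z is In6 z applied to this vector.
offDiagonal : Array3 → Vec ℤ 6
offDiagonal S = tabulate (uncurry S ∘ offDiagonalCell)

offDiagonal-injective : ∀ {S} → IsPermArray S → Injective _≡_ _≡_ (lookup (offDiagonal S))
offDiagonal-injective {S} (_ , cells-distinct) {j} {k} e =
  offDiagonalCell-injective (×-≡,≡→≡ (cells-distinct _ _ _ _ Sj≡Sk))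
  where
  Sj≡Sk : uncurry S (offDiagonalCell j) ≡ uncurry S (offDiagonalCell k)
  Sj≡Sk = trans (sym (lookup∘tabulate (uncurry S ∘ offDiagonalCell) j))
                (trans e (lookup∘tabulate (uncurry S ∘ offDiagonalCell) k))

offDiagonal-apart : ∀ {S} → IsPermArray S → ∀ j k → j ≢ k →
  lookup (offDiagonal S) j ≢ lookup (offDiagonal S) k
offDiagonal-apart perm j k j≢k = j≢k ∘ offDiagonal-injective perm

InX-bounded : ∀ {S} → IsPermArray S → InX S ⊆ Interval (+ 1) (+ 9)
InX-bounded (bounds , _) (inj₁ refl)                             = bounds _ _
InX-bounded (bounds , _) (inj₂ (inj₁ refl))                      = bounds _ _
InX-bounded (bounds , _) (inj₂ (inj₂ (inj₁ refl)))               = bounds _ _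
InX-bounded (bounds , _) (inj₂ (inj₂ (inj₂ (inj₁ refl))))        = bounds _ _
InX-bounded (bounds , _) (inj₂ (inj₂ (inj₂ (inj₂ (inj₁ refl))))) = bounds _ _
InX-bounded (bounds , _) (inj₂ (inj₂ (inj₂ (inj₂ (inj₂ refl))))) = bounds _ _

TripletSum-injective : ∀ {S y₁ y₂ y₃} → IsPermArray S → InX S ⊆ InTripletSum y₁ y₂ y₃ a →
  Injective _≡_ _≡_ (lookup (y₁ ∷ y₁ + a ∷ y₂ ∷ y₂ + a ∷ y₃ ∷ y₃ + a ∷ []))
TripletSum-injective perm X⊆sum =
  covering-injective (offDiagonal-injective perm) (λ j → In6⇒lookup (X⊆sum (lookup⇒In6 j)))

-- Raised and lowered entries

Raised Lowered : Array3 → Pred ℤ 0ℓ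
Raised S  = Triple (S i1 i2) (S i2 i3) (S i3 i1)
Lowered S = Triple (S i1 i3) (S i2 i1) (S i3 i2)

InX⇒Raised∪Lowered : ∀ {S} → InX S ⊆ Raised S ∪ Lowered S
InX⇒Raised∪Lowered (inj₁ e)                             = inj₁ (inj₁ e)
InX⇒Raised∪Lowered (inj₂ (inj₁ e))                      = inj₂ (inj₁ e)
InX⇒Raised∪Lowered (inj₂ (inj₂ (inj₁ e)))               = inj₂ (inj₂ (inj₁ e))
InX⇒Raised∪Lowered (inj₂ (inj₂ (inj₂ (inj₁ e))))        = inj₁ (inj₂ (inj₁ e))
InX⇒Raised∪Lowered (inj₂ (inj₂ (inj₂ (inj₂ (inj₁ e))))) = inj₁ (inj₂ (inj₂ e))
InX⇒Raised∪Lowered (inj₂ (inj₂ (inj₂ (inj₂ (inj₂ e))))) = inj₂ (inj₂ (inj₂ e))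

Raised∪Lowered⇒InX : ∀ {S} → Raised S ∪ Lowered S ⊆ InX S
Raised∪Lowered⇒InX (inj₁ (inj₁ e))        = inj₁ e
Raised∪Lowered⇒InX (inj₁ (inj₂ (inj₁ e))) = inj₂ (inj₂ (inj₂ (inj₁ e)))
Raised∪Lowered⇒InX (inj₁ (inj₂ (inj₂ e))) = inj₂ (inj₂ (inj₂ (inj₂ (inj₁ e))))
Raised∪Lowered⇒InX (inj₂ (inj₁ e))        = inj₂ (inj₁ e)
Raised∪Lowered⇒InX (inj₂ (inj₂ (inj₁ e))) = inj₂ (inj₂ (inj₁ e))
Raised∪Lowered⇒InX (inj₂ (inj₂ (inj₂ e))) = inj₂ (inj₂ (inj₂ (inj₂ (inj₂ e))))

Raised⊥Lowered : ∀ {S} → IsPermArray S → Raised S ⊥ Lowered S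
Raised⊥Lowered perm (inj₁ refl , inj₁ e)               = offDiagonal-apart perm (# 0) (# 1) (λ ()) e
Raised⊥Lowered perm (inj₁ refl , inj₂ (inj₁ e))        = offDiagonal-apart perm (# 0) (# 2) (λ ()) e
Raised⊥Lowered perm (inj₁ refl , inj₂ (inj₂ e))        = offDiagonal-apart perm (# 0) (# 5) (λ ()) e
Raised⊥Lowered perm (inj₂ (inj₁ refl) , inj₁ e)        = offDiagonal-apart perm (# 3) (# 1) (λ ()) e
Raised⊥Lowered perm (inj₂ (inj₁ refl) , inj₂ (inj₁ e)) = offDiagonal-apart perm (# 3) (# 2) (λ ()) e
Raised⊥Lowered perm (inj₂ (inj₁ refl) , inj₂ (inj₂ e)) = offDiagonal-apart perm (# 3) (# 5) (λ ()) e
Raised⊥Lowered perm (inj₂ (inj₂ refl) , inj₁ e)        = offDiagonal-apart perm (# 4) (# 1) (λ ()) e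
Raised⊥Lowered perm (inj₂ (inj₂ refl) , inj₂ (inj₁ e)) = offDiagonal-apart perm (# 4) (# 2) (λ ()) e
Raised⊥Lowered perm (inj₂ (inj₂ refl) , inj₂ (inj₂ e)) = offDiagonal-apart perm (# 4) (# 5) (λ ()) e

Raised-sorting : ∀ {S} → IsPermArray S → Sorting (S i1 i2) (S i2 i3) (S i3 i1)
Raised-sorting perm =
  sort (offDiagonal-apart perm (# 0) (# 3) (λ ()))
       (offDiagonal-apart perm (# 3) (# 4) (λ ()))
       (offDiagonal-apart perm (# 0) (# 4) (λ ()))

InShifted⇒cover : ∀ {S x} → InShifted S a x → Raised S (x - a) ⊎ Lowered S (x + a)
InShifted⇒cover (inj₁ e)                             = inj₁ (inj₁ (i≡j+k⇒i-k≡j e))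
InShifted⇒cover (inj₂ (inj₁ e))                      = inj₂ (inj₁ (i≡j-k⇒i+k≡j e))
InShifted⇒cover (inj₂ (inj₂ (inj₁ e)))               = inj₂ (inj₂ (inj₁ (i≡j-k⇒i+k≡j e)))
InShifted⇒cover (inj₂ (inj₂ (inj₂ (inj₁ e))))        = inj₁ (inj₂ (inj₁ (i≡j+k⇒i-k≡j e)))
InShifted⇒cover (inj₂ (inj₂ (inj₂ (inj₂ (inj₁ e))))) = inj₁ (inj₂ (inj₂ (i≡j+k⇒i-k≡j e)))
InShifted⇒cover (inj₂ (inj₂ (inj₂ (inj₂ (inj₂ e))))) = inj₂ (inj₂ (inj₂ (i≡j-k⇒i+k≡j e)))

module _ {S : Array3} (perm : IsPermArray S) (a≢0 : a ≢ 0ℤ) (X⊆shifted : InX S ⊆ InShifted S a) where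

  Raised-bounded : Raised S ⊆ Interval (+ 1) (+ 9)
  Raised-bounded Rx = InX-bounded perm (Raised∪Lowered⇒InX {S} (inj₁ Rx))

  Lowered-bounded : Lowered S ⊆ Interval (+ 1) (+ 9)
  Lowered-bounded Lx = InX-bounded perm (Raised∪Lowered⇒InX {S} (inj₂ Lx))

  Raised⊕≐Lowered : Raised S ⊕ a ≐ Lowered S
  Raised⊕≐Lowered =
    translate≐ a≢0 Raised-bounded Lowered-bounded (Raised⊥Lowered perm)
      (λ x∈R∪L → InShifted⇒cover {S = S} (X⊆shifted (Raised∪Lowered⇒InX {S} x∈R∪L)))

  InX≐Raised∪Raised⊕ : InX S ≐ Raised S ∪ Raised S ⊕ a
  InX≐Raised∪Raised⊕ =
    (λ x∈X → ⊎-map id (proj₂ Raised⊕≐Lowered) (InX⇒Raised∪Lowered {S} x∈X)) ,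
    (λ x∈R∪R⊕ → Raised∪Lowered⇒InX {S} (⊎-map id (proj₁ Raised⊕≐Lowered) x∈R∪R⊕))

  Raised⊥Raised⊕ : Raised S ⊥ Raised S ⊕ a
  Raised⊥Raised⊕ (Rx , R[x-a]) = Raised⊥Lowered perm (Rx , proj₁ Raised⊕≐Lowered R[x-a])

  TripletSum≐InX : ∀ {y₁ y₂ y₃} → Triple y₁ y₂ y₃ ≐ Raised S → InTripletSum y₁ y₂ y₃ a ≐ InX S
  TripletSum≐InX same = ≐-trans TripletSum≐Triple∪⊕ (≐-trans (∪-⊕-cong same) (≐-sym InX≐Raised∪Raised⊕))

  good⇒Triple≐Raised : ∀ {y₁ y₂ y₃} → GoodTriplet S a y₁ y₂ y₃ → Triple y₁ y₂ y₃ ≐ Raised S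
  good⇒Triple≐Raised {y₁} {y₂} {y₃} (X₁ , X₂ , X₃ , _ , _ , sum⇔X) =
    decomposition-unique a≢0 Raised-bounded (InX-bounded perm ∘ Triple⊆InX) Raised⊥Raised⊕
      (Triple⊥Triple⊕ (TripletSum-injective perm (Equivalence.from (sum⇔X _))))
      (≐-trans (≐-sym TripletSum≐Triple∪⊕)
        (≐-trans (Equivalence.to (sum⇔X _) , Equivalence.from (sum⇔X _)) InX≐Raised∪Raised⊕))
    where
    Triple⊆InX : Triple y₁ y₂ y₃ ⊆ InX S
    Triple⊆InX (inj₁ refl)        = X₁
    Triple⊆InX (inj₂ (inj₁ refl)) = X₂
    Triple⊆InX (inj₂ (inj₂ refl)) = X₃

lemma2p2 : (S : Array3) → IsPermArray S → (a : ℤ) → a ≢ + 0 →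
    (∀ z → InShifted S a z ⇔ InX S z) →
    Σ[ y₁ ∈ ℤ ] Σ[ y₂ ∈ ℤ ] Σ[ y₃ ∈ ℤ ]
      (GoodTriplet S a y₁ y₂ y₃ ×
       (∀ w₁ w₂ w₃ → GoodTriplet S a w₁ w₂ w₃ →
          (w₁ ≡ y₁) × (w₂ ≡ y₂) × (w₃ ≡ y₃)))
lemma2p2 S perm a a≢0 shifted⇔X =
  y₁ , y₂ , y₃ , (Triple⊆InX (inj₁ refl) , Triple⊆InX (inj₂ (inj₁ refl)) , Triple⊆InX (inj₂ (inj₂ refl)) , y₁<y₂ , y₂<y₃ , sum⇔X) ,
  λ w₁ w₂ w₃ good@(_ , _ , _ , w₁<w₂ , w₂<w₃ , _) →
    sorted-unique w₁<w₂ w₂<w₃ y₁<y₂ y₂<y₃ (≐-trans (good⇒Triple≐Raised perm a≢0 X⊆shifted good) (≐-sym same))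
  where
  open Sorting (Raised-sorting perm)
  X⊆shifted : InX S ⊆ InShifted S a
  X⊆shifted = Equivalence.from (shifted⇔X _)
  Triple⊆InX : Triple y₁ y₂ y₃ ⊆ InX S
  Triple⊆InX = proj₂ (InX≐Raised∪Raised⊕ perm a≢0 X⊆shifted) ∘ inj₁ ∘ proj₁ same
  sum⇔X : ∀ z → InTripletSum y₁ y₂ y₃ a z ⇔ InX S z
  sum⇔X z = let (to , from) = TripletSum≐InX perm a≢0 X⊆shifted same in mk⇔ to from
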